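{- Let $T(n)$ be the number of literals in the expression $E(1,n)$ of the square rhomboid $SR(n)$ produced by the one-vertex decomposition algorithm (1-VDA); let $\widehat{T}(n)$ be the number of literals in the 1-VDA expression of a single-leaf square rhomboid of size $n$; let $\widehat{\widehat{T}}_{pr}(n)$ and $\widehat{\widehat{T}}_{tr}(n)$ be the numbers of literals in the 1-VDA expressions of a parallelogram, respectively trapezoidal, dipterous square rhomboid of size $n$, and for $n>2$ let $\widehat{\widehat{T}}(n)$ denote their common value. Then: $T(1)=0$, $\widehat{T}(1)=1$, $\widehat{\widehat{T}}_{pr}(1)=2$, $\widehat{\widehat{T}}_{tr}(1)=3$; $T(2)=5$, $\widehat{T}(2)=8$, $\widehat{\widehat{T}}_{pr}(2)=12$, $\widehat{\widehat{T}}_{tr}(2)=11$; $\widehat{T}(3)=22$, $\widehat{\widehat{T}}(3)=28$; $\widehat{T}(4)=47$, $\widehat{\widehat{T}}(4)=60$; $\widehat{T}(5)=79$, $\widehat{\widehat{T}}(5)=92$; $\widehat{T}(6)=132$, $\widehat{\widehat{T}}(6)=150$; and $T(n)=T(\lceil n/2\rceil)+T(\lfloor n/2\rfloor+1)+2\widehat{T}(\lceil n/2\rceil-1)+2\widehat{T}(\lfloor n/2\rfloor)+2$ for $n>2$; $\widehat{T}(n)=T(\lfloor n/2\rfloor+1)+\widehat{T}(\lceil n/2\rceil)+2\widehat{T}(\lfloor n/2\rfloor)+2\widehat{\widehat{T}}(\lceil n/2\rceil-1)+2$ for $n>6$; $\widehat{\widehat{T}}(n)=\widehat{T}(\lceil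 n/2\rceil)+\widehat{T}(\lfloor n/2\rfloor+1)+2\widehat{\widehat{T}}(\lceil n/2\rceil-1)+2\widehat{\widehat{T}}(\lfloor n/2\rfloor)+2$ for $n>6$.
   Context: Square rhomboid. For an integer $n\ge 1$, the square rhomboid $SR(n)$ is the directed acyclic graph with basic vertices $1,\dots,n$, upper vertices $\overline{1},\dots,\overline{n-1}$ and lower vertices $\underline{1},\dots,\underline{n-1}$, and the following labeled edges (all labels are distinct literals): for $1\le v\le n-1$: $b_v:v\to v+1$, $e_{2v-1}:v\to\overline{v}$, $e_{2v}:\overline{v}\to v+1$, $d_{2v-1}:v\to\underline{v}$, $d_{2v}:\underline{v}\to v+1$; for $1\le v\le n-2$: $c_v:\overline{v}\to\overline{v+1}$ and $a_v:\underline{v}\to\underline{v+1}$. For vertices $x,y$ of a sufficiently large square rhomboid, the subgraph from $x$ to $y$ consists of all vertices and edges lying on directed paths from $x$ to $y$; its canonical expression is the sum, over all directed $x$–$y$ paths, of the product of the edge labels along the path. An expression of this subgraph is any expression built from the literals with $+$ and $\cdot$ that is algebraically equivalent to the canonical expression; its complexity is its total number of literal occurrences. Kinds of subgraphs: the subgraph from $p$ to $q$ ($p\le q$) is a square rhomboid of size $q-p+1$. The subgraphs from $p$ to $\overline{q}$ or to $\underline{q}$ ($p\le q$) are single-leaf square rhomboids of size $q-p+1$; those from $\overline{p}$ or $\underline{p}$ to $q$ ($p<q$) are single-leaf square rhomboids of size $q-p$. The subgraphs from $\overline{p}$ to $\overline{q}$ and from $\underline{p}$ to $\underline{q}$ ($p<q$)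 are trapezoidal dipterous square rhomboids of size $q-p$; those from $\underline{p}$ to $\overline{q}$ and from $\overline{p}$ to $\underline{q}$ ($p<q$) are parallelogram dipterous square rhomboids of size $q-p$. 1-VDA defines a formal expression $E(x,y)$ for each such subgraph by the rules: 1. $E(p,p)=1$; 2. $E(p,\overline{p})=e_{2p-1}$; 3. $E(p,\underline{p})=d_{2p-1}$; 4. $E(\overline{p},p+1)=e_{2p}$; 5. $E(\underline{p},p+1)=d_{2p}$; 6. $E(\overline{p},\overline{p+1})=c_p+e_{2p}e_{2p+1}$; 7. $E(\overline{p},\underline{p+1})=e_{2p}d_{2p+1}$; 8. $E(\underline{p},\overline{p+1})=d_{2p}e_{2p+1}$; 9. $E(\underline{p},\underline{p+1})=a_p+d_{2p}d_{2p+1}$; 10. $E(p,p+1)=b_p+e_{2p-1}e_{2p}+d_{2p-1}d_{2p}$; 11. $E(p,\overline{p+1})=(b_p+d_{2p-1}d_{2p})e_{2p+1}+e_{2p-1}(c_p+e_{2p}e_{2p+1})$; 12. $E(p,\underline{p+1})=(b_p+e_{2p-1}e_{2p})d_{2p+1}+d_{2p-1}(a_p+d_{2p}d_{2p+1})$; 13. $E(\overline{p},p+2)=(c_p+e_{2p}e_{2p+1})e_{2p+2}+e_{2p}(b_{p+1}+d_{2p+1}d_{2p+2})$; 14. $E(\underline{p},p+2)=(a_p+d_{2p}d_{2p+1})d_{2p+2}+d_{2p}(b_{p+1}+e_{2p+1}e_{2p+2})$; 15. $E(\overline{p},\overline{p+2})=e_{2p}(b_{p+1}+d_{2p+1}d_{2p+2})e_{2p+3}+(a_p+d_{2p}d_{2p+1})(a_{p+1}+d_{2p+2}d_{2p+3})$;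 16. $E(\overline{p},\underline{p+2})=e_{2p}(b_{p+1}d_{2p+3}+d_{2p+1}(a_{p+1}+d_{2p+2}d_{2p+3}))+(c_p+e_{2p}e_{2p+1})e_{2p+2}d_{2p+3}$; 17. $E(\underline{p},\overline{p+2})=d_{2p}(b_{p+1}e_{2p+3}+e_{2p+1}(c_{p+1}+e_{2p+2}e_{2p+3}))+(a_p+d_{2p}d_{2p+1})d_{2p+2}e_{2p+3}$; 18. $E(\underline{p},\underline{p+2})=d_{2p}(b_{p+1}+e_{2p+1}e_{2p+2})d_{2p+3}+(c_p+e_{2p}e_{2p+1})(c_{p+1}+e_{2p+2}e_{2p+3})$. Otherwise, writing $x\in\{p,\overline{p},\underline{p}\}$ and $y\in\{q,\overline{q},\underline{q}\}$, $E(x,y)=E(x,i)E(i,y)+E(x,\overline{i-1})\,c_{i-1}\,E(\overline{i},y)+E(x,\underline{i-1})\,a_{i-1}\,E(\underline{i},y)$, where: for $x=p$, $y\in\{\overline{q},\underline{q}\}$, $q>p+1$: $i=\lceil (q+p)/2\rceil$; for $x\in\{\overline{p},\underline{p}\}$, $y=q$, $q>p+2$: $i=\lceil (q+p)/2\rceil$; for $x\in\{\overline{p},\underline{p}\}$, $y\in\{\overline{q},\underline{q}\}$, $q>p+2$: $i=(q+p+1)/2$ (rounded up or down when not an integer); for $x=p$, $y=q$, $q>p+1$: $i=(q+p)/2$ (rounded up or down when not an integer). The number of literals of the 1-VDA expression of a subgraph depends only on its kind (square rhomboid, single-leaf, trapezoidal or parallelogram dipterous) and size; for $n>2$ the trapezoidal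 and parallelogram dipterous counts of size $n$ coincide. -}

module Defs where

open import Data.Nat using (ℕ; zero; suc; _+_; _*_; _∸_; ⌊_/2⌋; ⌈_/2⌉)
open import Data.Bool using (Bool; true; false)

-- Vertices of a (sufficiently large) square rhomboid:
-- bas p = p, up p = \overline{p}, low p = \underline{p}.
data Vertex : Set where
  bas up low : ℕ → Vertex

idx : Vertex → ℕ
idx (bas p) = p
idx (up p)  = p
idx (low p) = p

data Literal : Set where
  a b c d e : ℕ → Literal

infixl 6 _⊕_
infixl 7 _⊗_
data Expr : Set where
  one  : Expr
  lit  : Literal → Expr
  _⊕_  : Expr → Expr → Expr
  _⊗_  : Expr → Expr → Expr

literals : Expr → ℕ
literals one       = 0
literals (lit _)   = 1
literals (x ⊕ y)   = literals x + literals y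
literals (x ⊗ y)   = literals x + literals y

-- A rounding policy: where 1-VDA allows rounding (q+p)/2 resp. (q+p+1)/2
-- up or down, the policy says (for the current pair x y) whether to round up.
Policy : Set
Policy = Vertex → Vertex → Bool

round : Bool → ℕ → ℕ
round true  m = ⌈ m /2⌉
round false m = ⌊ m /2⌋

decomp : (Vertex → Vertex → Expr) → Vertex → Vertex → ℕ → Expr
decomp r x y i =
  r x (bas i) ⊗ r (bas i) y
  ⊕ r x (up (i ∸ 1)) ⊗ lit (c (i ∸ 1)) ⊗ r (up i) y
  ⊕ r x (low (i ∸ 1)) ⊗ lit (a (i ∸ 1)) ⊗ r (low i) y

-- One unfolding of the 1-VDA rules; r computes the recursive calls.
-- Pairs (x,y) not of any of the considered kinds get the dummy value one.
step : Policy → (Vertex → Vertex → Expr) → Vertex → Vertex → Expr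
step ρ r (bas p) (bas q) = go (q ∸ p)
  where
  go : ℕ → Expr
  go 0 = one
  go 1 = lit (b p) ⊕ lit (e (2 * p ∸ 1)) ⊗ lit (e (2 * p))
           ⊕ lit (d (2 * p ∸ 1)) ⊗ lit (d (2 * p))
  go m@(suc (suc _)) = decomp r (bas p) (bas q) (p + round (ρ (bas p) (bas q)) m)
step ρ r (bas p) (up q) = go (q ∸ p)
  where
  go : ℕ → Expr
  go 0 = lit (e (2 * p ∸ 1))
  go 1 = (lit (b p) ⊕ lit (d (2 * p ∸ 1)) ⊗ lit (d (2 * p))) ⊗ lit (e (2 * p + 1))
         ⊕ lit (e (2 * p ∸ 1)) ⊗ (lit (c p) ⊕ lit (e (2 * p)) ⊗ lit (e (2 * p + 1)))
  go m@(suc (suc _)) = decomp r (bas p) (up q) (p + ⌈ m /2⌉)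
step ρ r (bas p) (low q) = go (q ∸ p)
  where
  go : ℕ → Expr
  go 0 = lit (d (2 * p ∸ 1))
  go 1 = (lit (b p) ⊕ lit (e (2 * p ∸ 1)) ⊗ lit (e (2 * p))) ⊗ lit (d (2 * p + 1))
         ⊕ lit (d (2 * p ∸ 1)) ⊗ (lit (a p) ⊕ lit (d (2 * p)) ⊗ lit (d (2 * p + 1)))
  go m@(suc (suc _)) = decomp r (bas p) (low q) (p + ⌈ m /2⌉)
step ρ r (up p) (bas q) = go (q ∸ p)
  where
  go : ℕ → Expr
  go 0 = one
  go 1 = lit (e (2 * p))
  go 2 = (lit (c p) ⊕ lit (e (2 * p)) ⊗ lit (e (2 * p + 1))) ⊗ lit (e (2 * p + 2))
         ⊕ lit (e (2 * p)) ⊗ (lit (b (p + 1)) ⊕ lit (d (2 * p + 1)) ⊗ lit (d (2 * p + 2)))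
  go m@(suc (suc (suc _))) = decomp r (up p) (bas q) (p + ⌈ m /2⌉)
step ρ r (low p) (bas q) = go (q ∸ p)
  where
  go : ℕ → Expr
  go 0 = one
  go 1 = lit (d (2 * p))
  go 2 = (lit (a p) ⊕ lit (d (2 * p)) ⊗ lit (d (2 * p + 1))) ⊗ lit (d (2 * p + 2))
         ⊕ lit (d (2 * p)) ⊗ (lit (b (p + 1)) ⊕ lit (e (2 * p + 1)) ⊗ lit (e (2 * p + 2)))
  go m@(suc (suc (suc _))) = decomp r (low p) (bas q) (p + ⌈ m /2⌉)
step ρ r (up p) (up q) = go (q ∸ p)
  where
  go : ℕ → Expr
  go 0 = one
  go 1 = lit (c p) ⊕ lit (e (2 * p)) ⊗ lit (e (2 * p + 1))
  go 2 = lit (e (2 * p)) ⊗ (lit (b (p + 1)) ⊕ lit (d (2 * p + 1)) ⊗ lit (d (2 * p + 2))) ⊗ lit (e (2 * p + 3))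
         ⊕ (lit (a p) ⊕ lit (d (2 * p)) ⊗ lit (d (2 * p + 1)))
           ⊗ (lit (a (p + 1)) ⊕ lit (d (2 * p + 2)) ⊗ lit (d (2 * p + 3)))  -- rule 15 (as printed)
  go m@(suc (suc (suc _))) = decomp r (up p) (up q) (p + round (ρ (up p) (up q)) (suc m))
step ρ r (up p) (low q) = go (q ∸ p)
  where
  go : ℕ → Expr
  go 0 = one
  go 1 = lit (e (2 * p)) ⊗ lit (d (2 * p + 1))
  go 2 = lit (e (2 * p)) ⊗ (lit (b (p + 1)) ⊗ lit (d (2 * p + 3))
           ⊕ lit (d (2 * p + 1)) ⊗ (lit (a (p + 1)) ⊕ lit (d (2 * p + 2)) ⊗ lit (d (2 * p + 3))))
         ⊕ (lit (c p) ⊕ lit (e (2 * p)) ⊗ lit (e (2 * p + 1))) ⊗ lit (e (2 * p + 2)) ⊗ lit (d (2 * p + 3))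
  go m@(suc (suc (suc _))) = decomp r (up p) (low q) (p + round (ρ (up p) (low q)) (suc m))
step ρ r (low p) (up q) = go (q ∸ p)
  where
  go : ℕ → Expr
  go 0 = one
  go 1 = lit (d (2 * p)) ⊗ lit (e (2 * p + 1))
  go 2 = lit (d (2 * p)) ⊗ (lit (b (p + 1)) ⊗ lit (e (2 * p + 3))
           ⊕ lit (e (2 * p + 1)) ⊗ (lit (c (p + 1)) ⊕ lit (e (2 * p + 2)) ⊗ lit (e (2 * p + 3))))
         ⊕ (lit (a p) ⊕ lit (d (2 * p)) ⊗ lit (d (2 * p + 1))) ⊗ lit (d (2 * p + 2)) ⊗ lit (e (2 * p + 3))
  go m@(suc (suc (suc _))) = decomp r (low p) (up q) (p + round (ρ (low p) (up q)) (suc m))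
step ρ r (low p) (low q) = go (q ∸ p)
  where
  go : ℕ → Expr
  go 0 = one
  go 1 = lit (a p) ⊕ lit (d (2 * p)) ⊗ lit (d (2 * p + 1))
  go 2 = lit (d (2 * p)) ⊗ (lit (b (p + 1)) ⊕ lit (e (2 * p + 1)) ⊗ lit (e (2 * p + 2))) ⊗ lit (d (2 * p + 3))
         ⊕ (lit (c p) ⊕ lit (e (2 * p)) ⊗ lit (e (2 * p + 1)))
           ⊗ (lit (c (p + 1)) ⊕ lit (e (2 * p + 2)) ⊗ lit (e (2 * p + 3)))
  go m@(suc (suc (suc _))) = decomp r (low p) (low q) (p + round (ρ (low p) (low q)) (suc m))

-- Iterated unfolding with fuel (every recursive call strictly decreases q - p).
VDA-fuel : Policy → ℕ → Vertex → Vertex → Expr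
VDA-fuel ρ zero    _ _ = one
VDA-fuel ρ (suc f) x y = step ρ (VDA-fuel ρ f) x y

-- The 1-VDA expression E(x,y); fuel idx y + 2 exceeds the recursion depth.
E : Policy → Vertex → Vertex → Expr
E ρ x y = VDA-fuel ρ (suc (suc (idx y))) x y

-- Literal counts (representatives starting at vertex 1 / \overline{1} / \underline{1}).
T : Policy → ℕ → ℕ
T ρ n = literals (E ρ (bas 1) (bas n))

T̂ : Policy → ℕ → ℕ
T̂ ρ n = literals (E ρ (bas 1) (up n))

T̂̂tr : Policy → ℕ → ℕ
T̂̂tr ρ n = literals (E ρ (up 1) (up (suc n)))      -- trapezoidal dipterous, size n

T̂̂pr : Policy → ℕ → ℕ
T̂̂pr ρ n = literals (E ρ (low 1) (up (suc n)))     -- parallelogram dipterous, size n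

module Submission where

-- The number of literals of E(x,y) depends only on the kind of the subgraph from x to
-- y (square rhomboid, single-leaf, trapezoidal or parallelogram dipterous) and on its
-- size.  We capture this by a fuel-indexed function  count f κ n  that follows the
-- paper's recursion: fixed values for sizes 1 and 2 and, for n ≥ 3, the `recurrence`
-- in the counts at the halves ⌈n/2⌉ - 1 and ⌊n/2⌋.

open import Defs
open import Data.Nat using (ℕ; _+_; _*_; _∸_; _>_; ⌊_/2⌋; ⌈_/2⌉)
open import Data.Product using (_×_)
open import Relation.Binary.PropositionalEquality using (_≡_)

open import Data.Bool using (true; false)
open import Data.Nat using (zero; suc; _≤_; _<_; z≤n; s≤s; s≤s⁻¹)
open import Data.Nat.Properties
  using (+-comm; +-suc; +-identityʳ; +-mono-≤; m+n∸m≡n; m+n∸n≡m; ∸-+-assoc; m∸n≤m;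
         n<1+n; <-trans; <-≤-trans; m≤n⇒m<n∨m≡n; ⌊n/2⌋+⌈n/2⌉≡n; ⌊n/2⌋<n; ⌈n/2⌉<n; m≤n⇒∃[o]m+o≡n)
open import Data.Nat.Tactic.RingSolver using (solve-∀)
open import Data.Product using (_,_)
open import Data.Sum using (inj₁; inj₂)
open import Relation.Binary.PropositionalEquality using (refl; sym; trans; cong; cong₂; module ≡-Reasoning)
open ≡-Reasoning

double : ∀ x → x + x ≡ 2 * x
double x = cong (x +_) (sym (+-identityʳ x))

swap-pairs : ∀ x y u v z → x + y + u + v + z ≡ y + x + v + u + z
swap-pairs = solve-∀

m∸⌈m/2⌉≡⌊m/2⌋ : ∀ m → m ∸ ⌈ m /2⌉ ≡ ⌊ m /2⌋
m∸⌈m/2⌉≡⌊m/2⌋ m = trans (cong (_∸ ⌈ m /2⌉) (sym (⌊n/2⌋+⌈n/2⌉≡n m))) (m+n∸n≡m ⌊ m /2⌋ ⌈ m /2⌉)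

m∸⌊m/2⌋≡⌈m/2⌉ : ∀ m → m ∸ ⌊ m /2⌋ ≡ ⌈ m /2⌉
m∸⌊m/2⌋≡⌈m/2⌉ m = trans (cong (_∸ ⌊ m /2⌋) (sym (⌊n/2⌋+⌈n/2⌉≡n m))) (m+n∸m≡n ⌊ m /2⌋ ⌈ m /2⌉)

halves : (F : ℕ → ℕ → ℕ) → (∀ lo hi → F lo hi ≡ F hi lo) →
         ∀ r m → F (round r m) (m ∸ round r m) ≡ F ⌊ m /2⌋ ⌈ m /2⌉
halves F F-sym true m = begin
  F ⌈ m /2⌉ (m ∸ ⌈ m /2⌉)  ≡⟨ F-sym _ _ ⟩
  F (m ∸ ⌈ m /2⌉) ⌈ m /2⌉  ≡⟨ cong (λ lo → F lo ⌈ m /2⌉) (m∸⌈m/2⌉≡⌊m/2⌋ m) ⟩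
  F ⌊ m /2⌋ ⌈ m /2⌉        ∎
halves F F-sym false m = cong (F ⌊ m /2⌋) (m∸⌊m/2⌋≡⌈m/2⌉ m)

round-suc : ∀ r k → round r (2 + k) ≡ suc (round r k)
round-suc true  k = refl
round-suc false k = refl

data Kind : Set where
  rhomboid singleLeaf trapezoid parallelogram : Kind

data Wing : Set where
  upper lower : Wing

data Side : Set where
  basic : Side
  wing  : Wing → Side

side : Vertex → Side
side (bas _) = basic
side (up _)  = wing upper
side (low _) = wing lower

kind : Side → Side → Kind
kind basic        basic        = rhomboid
kind basic        (wing _)     = singleLeaf
kind (wing _)     basic        = singleLeaf
kind (wing upper) (wing upper) = trapezoid
kind (wing lower) (wing lower) = trapezoid
kind (wing upper) (wing lower) = parallelogram
kind (wing lower) (wing upper) = parallelogram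

-- a subgraph starting at a basic vertex has one more basic vertex than its distance
start : Side → ℕ
start basic    = 1
start (wing _) = 0

kindOf : Vertex → Vertex → Kind
kindOf x y = kind (side x) (side y)

size : Vertex → Vertex → ℕ
size x y = start (side x) + (idx y ∸ idx x)

-- E(x,y) is evaluated with fuel 2 + idx y, which exceeds the size of the subgraph
size-bound : ∀ x y → size x y < 2 + idx y
size-bound x y = s≤s (+-mono-≤ (start≤1 (side x)) (m∸n≤m (idx y) (idx x)))
  where
  start≤1 : ∀ s → start s ≤ 1
  start≤1 basic    = s≤s z≤n
  start≤1 (wing _) = z≤n

Count : Set
Count = Kind → ℕ → ℕ

-- the two dipterous kinds together (the paths through the upper and the lower wing)
wings : Count → ℕ → ℕ
wings N m = N trapezoid m + N parallelogram m

dipterous : Count → ℕ → ℕ → ℕ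
dipterous N lo hi = N singleLeaf (1 + lo) + N singleLeaf (1 + hi) + wings N lo + wings N hi + 2

-- The paper's recurrences, for a subgraph of size n with halves lo = ⌈n/2⌉ - 1 and hi = ⌊n/2⌋.
recurrence : Count → Kind → ℕ → ℕ → ℕ
recurrence N rhomboid lo hi =
  N rhomboid (1 + lo) + N rhomboid (1 + hi) + 2 * N singleLeaf lo + 2 * N singleLeaf hi + 2
recurrence N singleLeaf lo hi =
  N rhomboid (1 + hi) + N singleLeaf (1 + lo) + 2 * N singleLeaf hi + wings N lo + 2
recurrence N trapezoid     lo hi = dipterous N lo hi
recurrence N parallelogram lo hi = dipterous N lo hi

-- literal counts of the explicit rules 1-18 for subgraphs of size 1 and 2
sizeOne sizeTwo : Kind → ℕ
sizeOne rhomboid      = 0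
sizeOne singleLeaf    = 1
sizeOne trapezoid     = 3
sizeOne parallelogram = 2
sizeTwo rhomboid      = 5
sizeTwo singleLeaf    = 8
sizeTwo trapezoid     = 11
sizeTwo parallelogram = 12

count : ℕ → Count
count zero    _ _ = 0
count (suc f) κ 0 = 0
count (suc f) κ 1 = sizeOne κ
count (suc f) κ 2 = sizeTwo κ
count (suc f) κ n@(suc (suc (suc _))) = recurrence (count f) κ (⌈ n /2⌉ ∸ 1) ⌊ n /2⌋

AgreeBelow : Count → Count → ℕ → Set
AgreeBelow N N' n = ∀ κ m → 1 ≤ m → m < n → N κ m ≡ N' κ m

recurrence-cong : ∀ {N N'} κ lo hi →
  (∀ κ' → N κ' lo ≡ N' κ' lo) → (∀ κ' → N κ' (1 + lo) ≡ N' κ' (1 + lo)) →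
  (∀ κ' → N κ' hi ≡ N' κ' hi) → (∀ κ' → N κ' (1 + hi) ≡ N' κ' (1 + hi)) →
  recurrence N κ lo hi ≡ recurrence N' κ lo hi
recurrence-cong rhomboid lo hi ea esa eb esb
  rewrite esa rhomboid | esb rhomboid | ea singleLeaf | eb singleLeaf = refl
recurrence-cong singleLeaf lo hi ea esa eb esb
  rewrite esb rhomboid | esa singleLeaf | eb singleLeaf | ea trapezoid | ea parallelogram = refl
recurrence-cong trapezoid lo hi ea esa eb esb
  rewrite esa singleLeaf | esb singleLeaf | ea trapezoid | ea parallelogram
        | eb trapezoid | eb parallelogram = refl
recurrence-cong parallelogram lo hi ea esa eb esb
  rewrite esa singleLeaf | esb singleLeaf | ea trapezoid | ea parallelogram
        | eb trapezoid | eb parallelogram = refl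

recurrence-local : ∀ {N N'} κ k → AgreeBelow N N' (3 + k) →
  recurrence N κ (⌈ 3 + k /2⌉ ∸ 1) ⌊ 3 + k /2⌋ ≡ recurrence N' κ (⌈ 3 + k /2⌉ ∸ 1) ⌊ 3 + k /2⌋
recurrence-local κ k agree =
  recurrence-cong κ _ _ (λ κ' → agree κ' _ (s≤s z≤n) (<-trans (n<1+n _) 1+lo<n))
                        (λ κ' → agree κ' _ (s≤s z≤n) 1+lo<n)
                        (λ κ' → agree κ' _ (s≤s z≤n) (<-trans (n<1+n _) 1+hi<n))
                        (λ κ' → agree κ' _ (s≤s z≤n) 1+hi<n)
  where
  1+lo<n : ⌈ 3 + k /2⌉ < 3 + k
  1+lo<n = ⌈n/2⌉<n (suc k)
  1+hi<n : 1 + ⌊ 3 + k /2⌋ < 3 + k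
  1+hi<n = s≤s (s≤s (⌊n/2⌋<n k))

rhomboid-symmetric : ∀ N lo hi → recurrence N rhomboid lo hi ≡ recurrence N rhomboid hi lo
rhomboid-symmetric N lo hi =
  swap-pairs (N rhomboid (1 + lo)) (N rhomboid (1 + hi)) (2 * N singleLeaf lo) (2 * N singleLeaf hi) 2

dipterous-symmetric : ∀ N lo hi → dipterous N lo hi ≡ dipterous N hi lo
dipterous-symmetric N lo hi =
  swap-pairs (N singleLeaf (1 + lo)) (N singleLeaf (1 + hi)) (wings N lo) (wings N hi) 2

-- the two paths through the wings that leave, resp. enter, an endpoint of side s
wingPaths : Count → Side → ℕ → ℕ
wingPaths N basic    m = 2 * N singleLeaf m
wingPaths N (wing _) m = wings N m

wing-paths-from : ∀ N s m → N (kind s (wing upper)) m + N (kind s (wing lower)) m ≡ wingPaths N s m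
wing-paths-from N basic        m = double (N singleLeaf m)
wing-paths-from N (wing upper) m = refl
wing-paths-from N (wing lower) m = +-comm (N parallelogram m) (N trapezoid m)

wing-paths-to : ∀ N t m → N (kind (wing upper) t) m + N (kind (wing lower) t) m ≡ wingPaths N t m
wing-paths-to N basic        m = double (N singleLeaf m)
wing-paths-to N (wing upper) m = refl
wing-paths-to N (wing lower) m = +-comm (N parallelogram m) (N trapezoid m)

-- Count of decomposing an (s,t)-subgraph of distance δ at the basic vertex i + 1 steps
-- after its source: the pieces through that vertex, the wing paths around it, and the
-- two connecting literals.
splitCount : Count → Side → Side → ℕ → ℕ → ℕ
splitCount N s t δ i =
  N (kind s basic) (start s + suc i) + N (kind basic t) (1 + (δ ∸ suc i))
    + wingPaths N s (start s + i) + wingPaths N t (δ ∸ suc i) + 2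

Predicts : (Vertex → Vertex → Expr) → Count → Set
Predicts R N = ∀ x y → literals (R x y) ≡ N (kindOf x y) (size x y)

regroup : ∀ h₁ h₂ u₁ v₁ u₂ v₂ →
  h₁ + h₂ + ((u₁ + 1) + v₁) + ((u₂ + 1) + v₂) ≡ h₁ + h₂ + (u₁ + u₂) + (v₁ + v₂) + 2
regroup = solve-∀

decomposition-count : ∀ {R N} → Predicts R N → ∀ x y {δ} i → idx y ∸ idx x ≡ δ →
  literals (decomp R x y (idx x + suc i)) ≡ splitCount N (side x) (side y) δ i
decomposition-count {R} {N} predicts x y {δ} i dist = begin
    literals (decomp R x y j)
  ≡⟨ cong₂ _+_ (cong₂ _+_ (cong₂ _+_ (piece x (bas j) (m+n∸m≡n p (suc i))) (piece (bas j) y after))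
                          (cong₂ _+_ (cong (_+ 1) (piece x (up (j ∸ 1)) before)) (piece (up j) y after)))
               (cong₂ _+_ (cong (_+ 1) (piece x (low (j ∸ 1)) before)) (piece (low j) y after)) ⟩
    toMid + fromMid + ((toUpper + 1) + fromUpper) + ((toLower + 1) + fromLower)
  ≡⟨ regroup toMid fromMid toUpper fromUpper toLower fromLower ⟩
    toMid + fromMid + (toUpper + toLower) + (fromUpper + fromLower) + 2
  ≡⟨ cong₂ (λ u v → toMid + fromMid + u + v + 2) (wing-paths-from N s near) (wing-paths-to N t far) ⟩
    splitCount N s t δ i
  ∎
  where
  s t U L : Side
  s = side x
  t = side y
  U = wing upper
  L = wing lower
  p j near far : ℕ
  p = idx x
  j = p + suc i
  near = start s + i
  far = δ ∸ suc i
  toMid fromMid toUpper fromUpper toLower fromLower : ℕ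
  toMid     = N (kind s basic) (start s + suc i)
  fromMid   = N (kind basic t) (1 + far)
  toUpper   = N (kind s U) near
  fromUpper = N (kind U t) far
  toLower   = N (kind s L) near
  fromLower = N (kind L t) far
  piece : ∀ u v {m} → idx v ∸ idx u ≡ m → literals (R u v) ≡ N (kindOf u v) (start (side u) + m)
  piece u v eq = trans (predicts u v) (cong (λ m → N (kindOf u v) (start (side u) + m)) eq)
  before : j ∸ 1 ∸ p ≡ i
  before = trans (cong (λ z → z ∸ 1 ∸ p) (+-suc p i)) (m+n∸m≡n p i)
  after : idx y ∸ j ≡ far
  after = trans (sym (∸-+-assoc (idx y) p (suc i))) (cong (_∸ suc i) dist)

rhomboid-split : ∀ N r k →
  splitCount N basic basic (2 + k) (round r k) ≡ recurrence N rhomboid ⌊ 2 + k /2⌋ ⌈ 2 + k /2⌉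
rhomboid-split N true  k = halves (recurrence N rhomboid) (rhomboid-symmetric N) true  (2 + k)
rhomboid-split N false k = halves (recurrence N rhomboid) (rhomboid-symmetric N) false (2 + k)

single-split-from : ∀ N w k →
  splitCount N basic (wing w) (2 + k) ⌈ k /2⌉ ≡ recurrence N singleLeaf ⌊ 2 + k /2⌋ ⌈ 2 + k /2⌉
single-split-from N w k = cong (λ lo → recurrence N singleLeaf lo ⌈ 2 + k /2⌉) (m∸⌈m/2⌉≡⌊m/2⌋ (2 + k))

single-split-to : ∀ N w k →
  splitCount N (wing w) basic (3 + k) ⌈ 1 + k /2⌉ ≡ recurrence N singleLeaf ⌈ 1 + k /2⌉ ⌊ 3 + k /2⌋
single-split-to N w k =
  trans (swap-pairs (N singleLeaf ⌈ 3 + k /2⌉) (N rhomboid (1 + far))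
                    (wings N ⌈ 1 + k /2⌉) (2 * N singleLeaf far) 2)
        (cong (recurrence N singleLeaf ⌈ 1 + k /2⌉) (m∸⌈m/2⌉≡⌊m/2⌋ (3 + k)))
  where
  far : ℕ
  far = 3 + k ∸ ⌈ 3 + k /2⌉

dipterous-split : ∀ N w w' r k →
  splitCount N (wing w) (wing w') (3 + k) (round r (2 + k)) ≡ dipterous N ⌊ 2 + k /2⌋ ⌈ 2 + k /2⌉
dipterous-split N w w' r k = halves (dipterous N) (dipterous-symmetric N) r (2 + k)

vda-count : ∀ ρ f → Predicts (VDA-fuel ρ f) (count f)

vda-decomposition : ∀ ρ f x y {δ} i → idx y ∸ idx x ≡ δ →
  literals (decomp (VDA-fuel ρ f) x y (idx x + suc i)) ≡ splitCount (count f) (side x) (side y) δ i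

from-basic : ∀ ρ f p y →
  literals (VDA-fuel ρ (suc f) (bas p) y) ≡ count (suc f) (kindOf (bas p) y) (size (bas p) y)
from-basic ρ f p (bas q) with q ∸ p in dist
... | 0 = refl
... | 1 = refl
... | suc (suc k) rewrite round-suc (ρ (bas p) (bas q)) k =
  trans (vda-decomposition ρ f (bas p) (bas q) _ dist) (rhomboid-split (count f) (ρ (bas p) (bas q)) k)
from-basic ρ f p (up q) with q ∸ p in dist
... | 0 = refl
... | 1 = refl
... | suc (suc k) =
  trans (vda-decomposition ρ f (bas p) (up q) ⌈ k /2⌉ dist) (single-split-from (count f) upper k)
from-basic ρ f p (low q) with q ∸ p in dist
... | 0 = refl
... | 1 = refl
... | suc (suc k) =
  trans (vda-decomposition ρ f (bas p) (low q) ⌈ k /2⌉ dist) (single-split-from (count f) lower k)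

from-upper : ∀ ρ f p y →
  literals (VDA-fuel ρ (suc f) (up p) y) ≡ count (suc f) (kindOf (up p) y) (size (up p) y)
from-upper ρ f p (bas q) with q ∸ p in dist
... | 0 = refl
... | 1 = refl
... | 2 = refl
... | suc (suc (suc k)) =
  trans (vda-decomposition ρ f (up p) (bas q) ⌈ 1 + k /2⌉ dist) (single-split-to (count f) upper k)
from-upper ρ f p (up q) with q ∸ p in dist
... | 0 = refl
... | 1 = refl
... | 2 = refl
... | suc (suc (suc k)) rewrite round-suc (ρ (up p) (up q)) (2 + k) =
  trans (vda-decomposition ρ f (up p) (up q) _ dist)
        (dipterous-split (count f) upper upper (ρ (up p) (up q)) k)
from-upper ρ f p (low q) with q ∸ p in dist
... | 0 = refl
... | 1 = refl
... | 2 = refl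
... | suc (suc (suc k)) rewrite round-suc (ρ (up p) (low q)) (2 + k) =
  trans (vda-decomposition ρ f (up p) (low q) _ dist)
        (dipterous-split (count f) upper lower (ρ (up p) (low q)) k)

from-lower : ∀ ρ f p y →
  literals (VDA-fuel ρ (suc f) (low p) y) ≡ count (suc f) (kindOf (low p) y) (size (low p) y)
from-lower ρ f p (bas q) with q ∸ p in dist
... | 0 = refl
... | 1 = refl
... | 2 = refl
... | suc (suc (suc k)) =
  trans (vda-decomposition ρ f (low p) (bas q) ⌈ 1 + k /2⌉ dist) (single-split-to (count f) lower k)
from-lower ρ f p (up q) with q ∸ p in dist
... | 0 = refl
... | 1 = refl
... | 2 = refl
... | suc (suc (suc k)) rewrite round-suc (ρ (low p) (up q)) (2 + k) =
  trans (vda-decomposition ρ f (low p) (up q) _ dist)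
        (dipterous-split (count f) lower upper (ρ (low p) (up q)) k)
from-lower ρ f p (low q) with q ∸ p in dist
... | 0 = refl
... | 1 = refl
... | 2 = refl
... | suc (suc (suc k)) rewrite round-suc (ρ (low p) (low q)) (2 + k) =
  trans (vda-decomposition ρ f (low p) (low q) _ dist)
        (dipterous-split (count f) lower lower (ρ (low p) (low q)) k)

vda-count ρ zero    x       y = refl
vda-count ρ (suc f) (bas p) y = from-basic ρ f p y
vda-count ρ (suc f) (up p)  y = from-upper ρ f p y
vda-count ρ (suc f) (low p) y = from-lower ρ f p y

vda-decomposition ρ f = decomposition-count {R = VDA-fuel ρ f} {N = count f} (vda-count ρ f)

count-stable : ∀ f κ n → n < f → count (suc f) κ n ≡ count f κ n
count-stable (suc f) κ 0 _ = refl
count-stable (suc f) κ 1 _ = refl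
count-stable (suc f) κ 2 _ = refl
count-stable (suc f) κ (suc (suc (suc k))) n<1+f =
  recurrence-local κ k (λ κ' m _ m<n → count-stable f κ' m (<-≤-trans m<n (s≤s⁻¹ n<1+f)))

literalCount : Count
literalCount κ n = count (suc n) κ n

settles : ∀ f κ n → n < f → count f κ n ≡ literalCount κ n
settles (suc f) κ n n<1+f with m≤n⇒m<n∨m≡n (s≤s⁻¹ n<1+f)
... | inj₁ n<f  = trans (count-stable f κ n n<f) (settles f κ n n<f)
... | inj₂ refl = refl

E-count : ∀ ρ x y → literals (E ρ x y) ≡ literalCount (kindOf x y) (size x y)
E-count ρ x y =
  trans (vda-count ρ (2 + idx y) x y) (settles (2 + idx y) (kindOf x y) (size x y) (size-bound x y))

literalCount-recurrence : ∀ κ k →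
  literalCount κ (3 + k) ≡ recurrence literalCount κ (⌈ 3 + k /2⌉ ∸ 1) ⌊ 3 + k /2⌋
literalCount-recurrence κ k = recurrence-local κ k (λ κ' m _ m<n → settles (3 + k) κ' m m<n)

observed : Policy → Count
observed ρ rhomboid      = T ρ
observed ρ singleLeaf    = T̂ ρ
observed ρ trapezoid     = T̂̂tr ρ
observed ρ parallelogram = T̂̂pr ρ

observed-count : ∀ ρ κ m → observed ρ κ (suc m) ≡ literalCount κ (suc m)
observed-count ρ rhomboid      m = E-count ρ (bas 1) (bas (suc m))
observed-count ρ singleLeaf    m = E-count ρ (bas 1) (up (suc m))
observed-count ρ trapezoid     m = E-count ρ (up 1) (up (2 + m))
observed-count ρ parallelogram m = E-count ρ (low 1) (up (2 + m))

observed-recurrence : ∀ ρ κ k →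
  observed ρ κ (3 + k) ≡ recurrence (observed ρ) κ (⌈ 3 + k /2⌉ ∸ 1) ⌊ 3 + k /2⌋
observed-recurrence ρ κ k = begin
    observed ρ κ (3 + k)                                  ≡⟨ observed-count ρ κ (2 + k) ⟩
    literalCount κ (3 + k)                                ≡⟨ literalCount-recurrence κ k ⟩
    recurrence literalCount κ (⌈ 3 + k /2⌉ ∸ 1) ⌊ 3 + k /2⌋ ≡⟨ recurrence-local κ k agree ⟩
    recurrence (observed ρ) κ (⌈ 3 + k /2⌉ ∸ 1) ⌊ 3 + k /2⌋ ∎
  where
  agree : AgreeBelow literalCount (observed ρ) (3 + k)
  agree κ' (suc m) _ _ = sym (observed-count ρ κ' m)

parallelogram-trapezoid : ∀ ρ k → T̂̂pr ρ (3 + k) ≡ T̂̂tr ρ (3 + k)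
parallelogram-trapezoid ρ k =
  trans (observed-count ρ parallelogram (2 + k)) (sym (observed-count ρ trapezoid (2 + k)))

wings-observed : ∀ ρ k → wings (observed ρ) (3 + k) ≡ 2 * T̂̂tr ρ (3 + k)
wings-observed ρ k =
  trans (cong (T̂̂tr ρ (3 + k) +_) (parallelogram-trapezoid ρ k)) (double (T̂̂tr ρ (3 + k)))

dipterous-agree : ∀ ρ n → n > 2 → T̂̂pr ρ n ≡ T̂̂tr ρ n
dipterous-agree ρ n 2<n with m≤n⇒∃[o]m+o≡n 2<n
... | k , refl = parallelogram-trapezoid ρ k

T-recurrence : ∀ ρ n → n > 2 →
  T ρ n ≡ T ρ ⌈ n /2⌉ + T ρ (⌊ n /2⌋ + 1) + 2 * T̂ ρ (⌈ n /2⌉ ∸ 1) + 2 * T̂ ρ ⌊ n /2⌋ + 2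
T-recurrence ρ n 2<n with m≤n⇒∃[o]m+o≡n 2<n
... | k , refl = begin
    T ρ n
  ≡⟨ observed-recurrence ρ rhomboid k ⟩
    T ρ ⌈ n /2⌉ + T ρ (1 + ⌊ n /2⌋) + 2 * T̂ ρ (⌈ n /2⌉ ∸ 1) + 2 * T̂ ρ ⌊ n /2⌋ + 2
  ≡⟨ cong (λ z → T ρ ⌈ n /2⌉ + T ρ z + 2 * T̂ ρ (⌈ n /2⌉ ∸ 1) + 2 * T̂ ρ ⌊ n /2⌋ + 2) (+-comm 1 ⌊ n /2⌋) ⟩
    T ρ ⌈ n /2⌉ + T ρ (⌊ n /2⌋ + 1) + 2 * T̂ ρ (⌈ n /2⌉ ∸ 1) + 2 * T̂ ρ ⌊ n /2⌋ + 2
  ∎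

T̂-recurrence : ∀ ρ n → n > 6 →
  T̂ ρ n ≡ T ρ (⌊ n /2⌋ + 1) + T̂ ρ ⌈ n /2⌉ + 2 * T̂ ρ ⌊ n /2⌋ + 2 * T̂̂tr ρ (⌈ n /2⌉ ∸ 1) + 2
T̂-recurrence ρ n 6<n with m≤n⇒∃[o]m+o≡n 6<n
... | k , refl = begin
    T̂ ρ n
  ≡⟨ observed-recurrence ρ singleLeaf (4 + k) ⟩
    T ρ (1 + ⌊ n /2⌋) + T̂ ρ ⌈ n /2⌉ + 2 * T̂ ρ ⌊ n /2⌋ + wings (observed ρ) (⌈ n /2⌉ ∸ 1) + 2
  ≡⟨ cong₂ (λ z w → T ρ z + T̂ ρ ⌈ n /2⌉ + 2 * T̂ ρ ⌊ n /2⌋ + w + 2)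
           (+-comm 1 ⌊ n /2⌋) (wings-observed ρ ⌊ k /2⌋) ⟩
    T ρ (⌊ n /2⌋ + 1) + T̂ ρ ⌈ n /2⌉ + 2 * T̂ ρ ⌊ n /2⌋ + 2 * T̂̂tr ρ (⌈ n /2⌉ ∸ 1) + 2
  ∎

T̂̂-recurrence : ∀ ρ n → n > 6 →
  T̂̂tr ρ n ≡ T̂ ρ ⌈ n /2⌉ + T̂ ρ (⌊ n /2⌋ + 1) + 2 * T̂̂tr ρ (⌈ n /2⌉ ∸ 1) + 2 * T̂̂tr ρ ⌊ n /2⌋ + 2
T̂̂-recurrence ρ n 6<n with m≤n⇒∃[o]m+o≡n 6<n
... | k , refl = begin
    T̂̂tr ρ n
  ≡⟨ observed-recurrence ρ trapezoid (4 + k) ⟩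
    T̂ ρ ⌈ n /2⌉ + T̂ ρ (1 + ⌊ n /2⌋) + wings (observed ρ) (⌈ n /2⌉ ∸ 1) + wings (observed ρ) ⌊ n /2⌋ + 2
  ≡⟨ cong (λ z → T̂ ρ ⌈ n /2⌉ + T̂ ρ z + wings (observed ρ) (⌈ n /2⌉ ∸ 1) + wings (observed ρ) ⌊ n /2⌋ + 2)
          (+-comm 1 ⌊ n /2⌋) ⟩
    T̂ ρ ⌈ n /2⌉ + T̂ ρ (⌊ n /2⌋ + 1) + wings (observed ρ) (⌈ n /2⌉ ∸ 1) + wings (observed ρ) ⌊ n /2⌋ + 2
  ≡⟨ cong₂ (λ u v → T̂ ρ ⌈ n /2⌉ + T̂ ρ (⌊ n /2⌋ + 1) + u + v + 2)
           (wings-observed ρ ⌊ k /2⌋) (wings-observed ρ ⌊ 1 + k /2⌋) ⟩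
    T̂ ρ ⌈ n /2⌉ + T̂ ρ (⌊ n /2⌋ + 1) + 2 * T̂̂tr ρ (⌈ n /2⌉ ∸ 1) + 2 * T̂̂tr ρ ⌊ n /2⌋ + 2
  ∎

proposition1 : (ρ : Policy) →
    (T ρ 1 ≡ 0 × T̂ ρ 1 ≡ 1 × T̂̂pr ρ 1 ≡ 2 × T̂̂tr ρ 1 ≡ 3)
    × (T ρ 2 ≡ 5 × T̂ ρ 2 ≡ 8 × T̂̂pr ρ 2 ≡ 12 × T̂̂tr ρ 2 ≡ 11)
    × (∀ n → n > 2 → T̂̂pr ρ n ≡ T̂̂tr ρ n)
    × (T̂ ρ 3 ≡ 22 × T̂̂tr ρ 3 ≡ 28)
    × (T̂ ρ 4 ≡ 47 × T̂̂tr ρ 4 ≡ 60)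
    × (T̂ ρ 5 ≡ 79 × T̂̂tr ρ 5 ≡ 92)
    × (T̂ ρ 6 ≡ 132 × T̂̂tr ρ 6 ≡ 150)
    × (∀ n → n > 2 →
         T ρ n ≡ T ρ ⌈ n /2⌉ + T ρ (⌊ n /2⌋ + 1) + 2 * T̂ ρ (⌈ n /2⌉ ∸ 1) + 2 * T̂ ρ ⌊ n /2⌋ + 2)
    × (∀ n → n > 6 →
         T̂ ρ n ≡ T ρ (⌊ n /2⌋ + 1) + T̂ ρ ⌈ n /2⌉ + 2 * T̂ ρ ⌊ n /2⌋ + 2 * T̂̂tr ρ (⌈ n /2⌉ ∸ 1) + 2)
    × (∀ n → n > 6 →
         T̂̂tr ρ n ≡ T̂ ρ ⌈ n /2⌉ + T̂ ρ (⌊ n /2⌋ + 1) + 2 * T̂̂tr ρ (⌈ n /2⌉ ∸ 1) + 2 * T̂̂tr ρ ⌊ n /2⌋ + 2)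
proposition1 ρ =
    (value rhomboid 0 , value singleLeaf 0 , value parallelogram 0 , value trapezoid 0)
  , (value rhomboid 1 , value singleLeaf 1 , value parallelogram 1 , value trapezoid 1)
  , dipterous-agree ρ
  , (value singleLeaf 2 , value trapezoid 2)
  , (value singleLeaf 3 , value trapezoid 3)
  , (value singleLeaf 4 , value trapezoid 4)
  , (value singleLeaf 5 , value trapezoid 5)
  , T-recurrence ρ , T̂-recurrence ρ , T̂̂-recurrence ρ
  where
  -- the small values are computed by evaluating literalCount
  value : ∀ κ m → observed ρ κ (suc m) ≡ literalCount κ (suc m)
  value = observed-count ρ
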